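{- Let $G$ and $H$ be graphs with $n$ vertices and $m$ edges. If the modified $1$-decks $MD_1(G)$ and $MD_1(H)$ agree as multisets of isomorphism classes, then the $1$-edge decks $ED_1(G)$ and $ED_1(H)$ agree as multisets of isomorphism classes. In other words, the $1$-edge deck of a graph can be constructed from its modified $1$-deck.
   Context: All graphs are simple. For a graph $G$, the $1$-edge deck $ED_1(G)$ is the multiset of the graphs $G-e$, $e\in E(G)$. The modified $1$-deck $MD_1(G)$ is the multiset of graphs $G-e+f$ where $e$ ranges over $E(G)$ and $f$ ranges over all non-edges of $G-e$ (including $f=e$), i.e. one edge is removed in all possible ways and one edge, not necessarily new, is added in all possible ways. -}

module Defs where

open import Data.Nat using (ℕ)
open import Data.Bool using (Bool; true; false; _∧_; _∨_; not; T)
open import Data.Fin using (Fin; _<_; _<?_)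
open import Data.Fin.Properties using (_≟_)
open import Data.List using (List; []; _∷_; concatMap; filter; map; length; allFin; lookup)
open import Data.Product using (_×_; _,_; Σ)
open import Relation.Binary.PropositionalEquality using (_≡_)
open import Relation.Nullary.Decidable using (⌊_⌋; does)
open import Function.Bundles using (_↔_; Inverse)

Adj : ℕ → Set
Adj n = Fin n → Fin n → Bool

record IsSimple {n : ℕ} (G : Adj n) : Set where
  field
    sym     : ∀ x y → G x y ≡ G y x
    irrefl  : ∀ x → G x x ≡ false

-- Unordered pairs {i,j} of distinct vertices, represented as (i , j) with i < j.
Pair : ℕ → Set
Pair n = Fin n × Fin n

pairs : (n : ℕ) → List (Pair n)
pairs n = concatMap (λ i → map (λ j → (i , j)) (filter (λ j → i <? j) (allFin n))) (allFin n)

edges : {n : ℕ} → Adj n → List (Pair n)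
edges {n} G = filter (λ p → T? (G (Data.Product.proj₁ p) (Data.Product.proj₂ p))) (pairs n)
  where
  open import Relation.Nullary.Decidable using (T?)

nonEdges : {n : ℕ} → Adj n → List (Pair n)
nonEdges {n} G = filter (λ p → T? (not (G (Data.Product.proj₁ p) (Data.Product.proj₂ p)))) (pairs n)
  where
  open import Relation.Nullary.Decidable using (T?)

isPair : {n : ℕ} → Pair n → Fin n → Fin n → Bool
isPair (a , b) x y = (⌊ x ≟ a ⌋ ∧ ⌊ y ≟ b ⌋) ∨ (⌊ x ≟ b ⌋ ∧ ⌊ y ≟ a ⌋)

delete : {n : ℕ} → Adj n → Pair n → Adj n
delete G e x y = G x y ∧ not (isPair e x y)

add : {n : ℕ} → Adj n → Pair n → Adj n
add G f x y = G x y ∨ isPair f x y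

ED₁ : {n : ℕ} → Adj n → List (Adj n)
ED₁ G = map (delete G) (edges G)

-- modified 1-deck: G - e + f, e ∈ E(G), f a non-edge of G - e (including f = e).
MD₁ : {n : ℕ} → Adj n → List (Adj n)
MD₁ G = concatMap (λ e → map (add (delete G e)) (nonEdges (delete G e))) (edges G)

_≅_ : {n : ℕ} → Adj n → Adj n → Set
_≅_ {n} G H = Σ (Fin n ↔ Fin n) λ σ → ∀ x y → G x y ≡ H (Inverse.to σ x) (Inverse.to σ y)

_≈ₘ_ : {n : ℕ} → List (Adj n) → List (Adj n) → Set
L ≈ₘ M = Σ (Fin (length L) ↔ Fin (length M)) λ π → ∀ i → lookup L i ≅ lookup M (Inverse.to π i)

{-# OPTIONS --safe #-}

-- Let #iso X Y be the number of isomorphisms X → Y. A bijection σ is an isomorphism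
-- G − e → K exactly when the pair σ(e) is a non-edge of K and σ is an isomorphism
-- G → K + σ(e); counting these pairs (e , σ) in two ways gives
--   Σ_{e ∈ E(G)} #iso (G − e) K  =  Σ_{f ∉ E(K)} #iso G (K + f).
-- Taking K = H − e′ and summing over e′ ∈ E(H) shows that
--   ⟪ ED₁ G , ED₁ H ⟫ := Σ_{X ∈ ED₁ G} Σ_{Y ∈ ED₁ H} #iso X Y  =  Σ_{Y ∈ MD₁ H} #iso G Y,
-- so if MD₁ G and MD₁ H agree, then ⟪a,b⟫ + ⟪b,a⟫ = ⟪a,a⟫ + ⟪b,b⟫ for a = ED₁ G, b = ED₁ H.
-- As #iso X Y is |Aut X| when X ≅ Y and 0 otherwise, the difference of the two sides is
-- Σ_C |Aut C| (a_C − b_C)² over isomorphism classes C, so a and b agree class by class.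

module Submission where

open import Defs
open import Level using (Level)
open import Data.Nat using (ℕ; zero; suc; _+_; _<_; _≤_; _<?_; z≤n; s≤s)
open import Data.Nat.Properties
  using ( ≤-trans; <⇒≤; <⇒≱; ≮⇒≥; n≮0; n≤0⇒n≡0; m≤n+m; m≤m+n; m<n+m
        ; +-monoʳ-≤; +-monoˡ-<; +-cancelˡ-≡; +-0-commutativeMonoid; module ≤-Reasoning)
open import Data.Nat.ListAction using (sum)
open import Data.Nat.ListAction.Properties using (sum-↭; sum-++)
open import Data.Nat.Tactic.RingSolver using (solve-∀)
open import Data.Bool using (Bool; true; false; _∧_; _∨_; not; T; if_then_else_)
open import Data.Bool.Properties
  using (∧-comm; ∨-comm; ∧-zeroʳ; ∧-identityʳ; ∨-zeroʳ; ∨-identityʳ; T-≡; T-not-≡)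
  renaming (_≟_ to _≟ᵇ_)
open import Data.Fin as Fin using (Fin)
open import Data.Fin.Properties using (_≟_; all?; <-cmp; <-asym; <⇒≢)
open import Data.List as List
  using (List; []; _∷_; _++_; map; concatMap; filter; length; allFin; cartesianProduct; cartesianProductWith)
open import Data.List.Properties using (map-++; map-cong; map-cong-local; map-∘; map-id; filter-++)
open import Data.List.Membership.Propositional using (_∈_)
open import Data.List.Membership.Propositional.Properties
  using (∈-map⁺; ∈-map⁻; ∈-filter⁺; ∈-filter⁻; ∈-cartesianProduct⁺; ∈-cartesianProductWith⁺; ∈-allFin)
open import Data.List.Membership.Propositional.Properties.WithK using (unique∧set⇒bag)
open import Data.List.Relation.Binary.BagAndSetEquality using (∼bag⇒↭)
open import Data.List.Relation.Binary.Permutation.Propositional using (_↭_)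
import Data.List.Relation.Binary.Permutation.Propositional.Properties as ↭
open import Data.List.Relation.Binary.Permutation.Homogeneous using (onIndices)
open import Data.List.Relation.Binary.Permutation.Setoid.Properties using (onIndices-lookup)
open import Data.List.Relation.Unary.All as All using (All; []; _∷_)
open import Data.List.Relation.Unary.Any using (here; there)
open import Data.List.Relation.Unary.Unique.Propositional using (Unique; []; _∷_)
import Data.List.Relation.Unary.Unique.Propositional.Properties as Unique
open import Data.Vec using (Vec; []; _∷_; lookup; tabulate)
open import Data.Vec.Properties using (∷-injective; lookup∘tabulate; tabulate∘lookup; tabulate-cong)
open import Data.Product using (_×_; _,_; ∃; proj₁; proj₂)
open import Data.Sum using (_⊎_; inj₁; inj₂)
open import Data.Empty using (⊥-elim)
open import Function using (_∘_; id; _↔_; Inverse; Equivalence; mk⇔; mk↔ₛ′)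
open import Relation.Nullary using (Dec; yes; no; ¬_; does)
open import Relation.Nullary.Decidable using (⌊_⌋; map′; _×-dec_; T?)
open import Relation.Unary using (Pred; Decidable)
open import Relation.Binary using (Rel; Setoid)
open import Relation.Binary.Definitions using (tri<; tri≈; tri>)
open import Relation.Binary.PropositionalEquality
import Algebra.Properties.CommutativeMonoid.Sum +-0-commutativeMonoid as FinSum

private variable
  ℓ ℓ′ : Level
  A B : Set ℓ

∑ : List A → (A → ℕ) → ℕ
∑ xs f = sum (map f xs)

syntax ∑ xs (λ x → e) = ∑[ x ∈ xs ] e

∑-cong : {f g : A → ℕ} (xs : List A) → (∀ x → f x ≡ g x) → ∑ xs f ≡ ∑ xs g
∑-cong xs f≗g = cong sum (map-cong f≗g xs)

∑-↭ : (f : A → ℕ) {xs ys : List A} → xs ↭ ys → ∑ xs f ≡ ∑ ys f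
∑-↭ f p = sum-↭ (↭.map⁺ f p)

∑-map : (f : B → ℕ) (g : A → B) (xs : List A) → ∑ (map g xs) f ≡ ∑ xs (f ∘ g)
∑-map f g []       = refl
∑-map f g (x ∷ xs) = cong (f (g x) +_) (∑-map f g xs)

∑-++ : (f : A → ℕ) (xs ys : List A) → ∑ (xs ++ ys) f ≡ ∑ xs f + ∑ ys f
∑-++ f xs ys = trans (cong sum (map-++ f xs ys)) (sum-++ (map f xs) (map f ys))

∑-concatMap : (f : B → ℕ) (g : A → List B) (xs : List A) →
              ∑ (concatMap g xs) f ≡ ∑[ x ∈ xs ] ∑ (g x) f
∑-concatMap f g []       = refl
∑-concatMap f g (x ∷ xs) = trans (∑-++ f (g x) (concatMap g xs)) (cong (∑ (g x) f +_) (∑-concatMap f g xs))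

∑-zero : (xs : List A) → ∑[ x ∈ xs ] 0 ≡ 0
∑-zero []       = refl
∑-zero (x ∷ xs) = ∑-zero xs

∑-+ : (f g : A → ℕ) (xs : List A) → ∑[ x ∈ xs ] (f x + g x) ≡ ∑ xs f + ∑ xs g
∑-+ f g []       = refl
∑-+ f g (x ∷ xs) rewrite ∑-+ f g xs = interchange (f x) (g x) (∑ xs f) (∑ xs g)
  where
  interchange : ∀ p q r s → (p + q) + (r + s) ≡ (p + r) + (q + s)
  interchange = solve-∀

∑-comm : (f : A → B → ℕ) (xs : List A) (ys : List B) →
         ∑[ x ∈ xs ] ∑[ y ∈ ys ] f x y ≡ ∑[ y ∈ ys ] ∑[ x ∈ xs ] f x y
∑-comm f []       ys = sym (∑-zero ys)
∑-comm f (x ∷ xs) ys = trans (cong (∑ ys (f x) +_) (∑-comm f xs ys))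
                             (sym (∑-+ (f x) (λ y → ∑[ x ∈ xs ] f x y) ys))

module _ {xs ys : List A} (g h : A → A)
         (g∈ : ∀ {x} → x ∈ xs → g x ∈ ys) (h∈ : ∀ {y} → y ∈ ys → h y ∈ xs)
         (hg : ∀ {x} → x ∈ xs → h (g x) ≡ x) (gh : ∀ {y} → y ∈ ys → g (h y) ≡ y) where

  map-bijection-↭ : Unique xs → Unique ys → map g xs ↭ ys
  map-bijection-↭ xs! ys! = ∼bag⇒↭ (unique∧set⇒bag gxs! ys! (mk⇔ to from))
    where
    gxs! : Unique (map g xs)
    gxs! = Unique.map⁻ {f = h} (subst Unique (sym hgxs≡xs) xs!)
      where
      hgxs≡xs : map h (map g xs) ≡ xs
      hgxs≡xs = begin
        map h (map g xs)  ≡⟨ map-∘ xs ⟨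
        map (h ∘ g) xs    ≡⟨ map-cong-local (All.tabulate hg) ⟩
        map id xs         ≡⟨ map-id xs ⟩
        xs                ∎
        where open ≡-Reasoning
    to : ∀ {y} → y ∈ map g xs → y ∈ ys
    to y∈ with ∈-map⁻ g y∈
    ... | x , x∈ , refl = g∈ x∈
    from : ∀ {y} → y ∈ ys → y ∈ map g xs
    from y∈ = subst (_∈ map g xs) (gh y∈) (∈-map⁺ g (h∈ y∈))

  ∑-reindex : Unique xs → Unique ys → (f : A → ℕ) → ∑ xs (f ∘ g) ≡ ∑ ys f
  ∑-reindex xs! ys! f = trans (sym (∑-map f g xs)) (∑-↭ f (map-bijection-↭ xs! ys!))

∑-lookup : (f : A → ℕ) (xs : List A) → ∑ xs f ≡ FinSum.sum (f ∘ List.lookup xs)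
∑-lookup f []       = refl
∑-lookup f (x ∷ xs) = cong (f x +_) (∑-lookup f xs)

∑-permute : (f g : A → ℕ) {xs ys : List A} (π : Fin (length xs) ↔ Fin (length ys)) →
            (∀ i → f (List.lookup xs i) ≡ g (List.lookup ys (Inverse.to π i))) → ∑ xs f ≡ ∑ ys g
∑-permute f g {xs} {ys} π f≗g∘π = begin
  ∑ xs f                                         ≡⟨ ∑-lookup f xs ⟩
  FinSum.sum (f ∘ List.lookup xs)                 ≡⟨ FinSum.sum-cong-≗ f≗g∘π ⟩
  FinSum.sum (g ∘ List.lookup ys ∘ Inverse.to π)  ≡⟨ FinSum.sum-permute (g ∘ List.lookup ys) π ⟨
  FinSum.sum (g ∘ List.lookup ys)                 ≡⟨ ∑-lookup g ys ⟨
  ∑ ys g                                         ∎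
  where open ≡-Reasoning

𝟙 : {P : Set ℓ} → Dec P → ℕ
𝟙 P? = if does P? then 1 else 0

module _ {P : Set ℓ} {Q : Set ℓ′} where

  𝟙-cong : (P? : Dec P) (Q? : Dec Q) → (P → Q) → (Q → P) → 𝟙 P? ≡ 𝟙 Q?
  𝟙-cong (yes p) (yes q) P→Q Q→P = refl
  𝟙-cong (no ¬p) (no ¬q) P→Q Q→P = refl
  𝟙-cong (yes p) (no ¬q) P→Q Q→P = ⊥-elim (¬q (P→Q p))
  𝟙-cong (no ¬p) (yes q) P→Q Q→P = ⊥-elim (¬p (Q→P q))

module _ {P : Pred A ℓ} (P? : Decidable P) where

  ∑-𝟙-filter : {Q : Pred A ℓ′} (Q? : Decidable Q) (xs : List A) →
               ∑[ x ∈ filter P? xs ] 𝟙 (Q? x) ≡ ∑[ x ∈ xs ] 𝟙 (P? x ×-dec Q? x)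
  ∑-𝟙-filter Q? []       = refl
  ∑-𝟙-filter Q? (x ∷ xs) with does (P? x)
  ... | true  = cong (𝟙 (Q? x) +_) (∑-𝟙-filter Q? xs)
  ... | false = ∑-𝟙-filter Q? xs

  ∑-𝟙-pos⇒∃ : (xs : List A) → 0 < ∑[ x ∈ xs ] 𝟙 (P? x) → ∃ P
  ∑-𝟙-pos⇒∃ (x ∷ xs) pos with P? x
  ... | yes p = x , p
  ... | no _  = ∑-𝟙-pos⇒∃ xs pos

  ∑-𝟙-pos : {x : A} {xs : List A} → x ∈ xs → P x → 0 < ∑[ x ∈ xs ] 𝟙 (P? x)
  ∑-𝟙-pos {x} (here refl) p with P? x
  ... | yes _ = s≤s z≤n
  ... | no ¬p = ⊥-elim (¬p p)
  ∑-𝟙-pos {xs = y ∷ _} (there x∈) p = ≤-trans (∑-𝟙-pos x∈ p) (m≤n+m _ (𝟙 (P? y)))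

  ∑-𝟙-none : (xs : List A) → (∀ x → ¬ P x) → ∑[ x ∈ xs ] 𝟙 (P? x) ≡ 0
  ∑-𝟙-none []       ¬P = refl
  ∑-𝟙-none (x ∷ xs) ¬P with P? x
  ... | yes p = ⊥-elim (¬P x p)
  ... | no _  = ∑-𝟙-none xs ¬P

-- Kernels that separate multisets

-- ⟪ xs , ys ⟫ = Σ_C w_C · |xs ∩ C| · |ys ∩ C| over the ∼-classes C, with w_C = c x x for x ∈ C,
-- so pure xs ys − mixed xs ys = Σ_C w_C (|xs ∩ C| − |ys ∩ C|)².
module PositiveKernel {a} {A : Set a} (c : A → A → ℕ)
  (c-pos   : ∀ x → 0 < c x x)
  (c-congˡ : ∀ {x y} z → 0 < c x y → c x z ≡ c y z)
  (c-congʳ : ∀ {x y} z → 0 < c x y → c z x ≡ c z y) where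

  infix 4 _∼_ _∼?_

  _∼_ : Rel A _
  x ∼ y = 0 < c x y

  _∼?_ : ∀ x y → Dec (x ∼ y)
  x ∼? y = 0 <? c x y

  ∼-sym : ∀ {x y} → x ∼ y → y ∼ x
  ∼-sym {x} x∼y = subst (0 <_) (c-congˡ x x∼y) (c-pos x)

  ∼-trans : ∀ {x y z} → x ∼ y → y ∼ z → x ∼ z
  ∼-trans {z = z} x∼y y∼z = subst (0 <_) (sym (c-congˡ z x∼y)) y∼z

  ∼-setoid : Setoid a _
  ∼-setoid = record
    { _≈_ = _∼_
    ; isEquivalence = record { refl = c-pos _ ; sym = ∼-sym ; trans = ∼-trans }
    }

  open import Data.List.Relation.Binary.Permutation.Setoid ∼-setoid as ∼Perm public
    using () renaming (_↭_ to _↭∼_)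
  open import Data.List.Relation.Binary.Permutation.Setoid.Properties ∼-setoid
    using () renaming (shift to ↭∼-shift)

  ⟪_,_⟫ : List A → List A → ℕ
  ⟪ xs , ys ⟫ = ∑[ x ∈ xs ] ∑[ y ∈ ys ] c x y

  mixed pure : List A → List A → ℕ
  mixed xs ys = ⟪ xs , ys ⟫ + ⟪ ys , xs ⟫
  pure  xs ys = ⟪ xs , xs ⟫ + ⟪ ys , ys ⟫

  row col : A → List A → ℕ
  row x ys = ∑ ys (c x)
  col y xs = ∑[ x ∈ xs ] c x y

  ⟪⟫-∷ʳ : ∀ xs y ys → ⟪ xs , y ∷ ys ⟫ ≡ col y xs + ⟪ xs , ys ⟫
  ⟪⟫-∷ʳ xs y ys = ∑-+ (λ x → c x y) (λ x → row x ys) xs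

  ⟪⟫-∷∷ : ∀ x xs y ys → ⟪ x ∷ xs , y ∷ ys ⟫ ≡ (c x y + row x ys) + (col y xs + ⟪ xs , ys ⟫)
  ⟪⟫-∷∷ x xs y ys = cong (c x y + row x ys +_) (⟪⟫-∷ʳ xs y ys)

  ⟪⟫-∼ˡ : ∀ {x y} → x ∼ y → ∀ xs ys → ⟪ x ∷ xs , ys ⟫ ≡ ⟪ y ∷ xs , ys ⟫
  ⟪⟫-∼ˡ x∼y xs ys = cong (_+ ⟪ xs , ys ⟫) (∑-cong ys (λ z → c-congˡ z x∼y))

  ⟪⟫-∼ʳ : ∀ {x y} → x ∼ y → ∀ xs ys → ⟪ xs , x ∷ ys ⟫ ≡ ⟪ xs , y ∷ ys ⟫
  ⟪⟫-∼ʳ x∼y xs ys = ∑-cong xs (λ z → cong (_+ row z ys) (c-congʳ z x∼y))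

  ⟪⟫-↭ˡ : ∀ {xs xs′} ys → xs ↭ xs′ → ⟪ xs , ys ⟫ ≡ ⟪ xs′ , ys ⟫
  ⟪⟫-↭ˡ ys p = ∑-↭ (λ x → row x ys) p

  ⟪⟫-↭ʳ : ∀ xs {ys ys′} → ys ↭ ys′ → ⟪ xs , ys ⟫ ≡ ⟪ xs , ys′ ⟫
  ⟪⟫-↭ʳ xs p = ∑-cong xs (λ x → ∑-↭ (c x) p)

  ⟪⟫-self-< : ∀ x xs → ⟪ xs , xs ⟫ < ⟪ x ∷ xs , x ∷ xs ⟫
  ⟪⟫-self-< x xs = begin-strict
    ⟪ xs , xs ⟫                                             ≤⟨ m≤n+m _ (col x xs) ⟩
    col x xs + ⟪ xs , xs ⟫                                  <⟨ m<n+m _ (≤-trans (c-pos x) (m≤m+n _ (row x xs))) ⟩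
    (c x x + row x xs) + (col x xs + ⟪ xs , xs ⟫)           ≡⟨ ⟪⟫-∷∷ x xs x xs ⟨
    ⟪ x ∷ xs , x ∷ xs ⟫                                     ∎
    where open ≤-Reasoning

  shared : A → List A → List A → ℕ
  shared x xs ys = (c x x + row x xs + col x xs) + (c x x + row x ys + col x ys)

  mixed-∷ : ∀ x xs ys → mixed (x ∷ xs) (x ∷ ys) ≡ shared x xs ys + mixed xs ys
  mixed-∷ x xs ys = trans (cong₂ _+_ (⟪⟫-∷∷ x xs x ys) (⟪⟫-∷∷ x ys x xs))
    (regroup (c x x) (row x xs) (row x ys) (col x xs) (col x ys) ⟪ xs , ys ⟫ ⟪ ys , xs ⟫)
    where
    regroup : ∀ C R₁ R₂ K₁ K₂ S T →
      ((C + R₂) + (K₁ + S)) + ((C + R₁) + (K₂ + T)) ≡ ((C + R₁ + K₁) + (C + R₂ + K₂)) + (S + T)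
    regroup = solve-∀

  pure-∷ : ∀ x xs ys → pure (x ∷ xs) (x ∷ ys) ≡ shared x xs ys + pure xs ys
  pure-∷ x xs ys = trans (cong₂ _+_ (⟪⟫-∷∷ x xs x xs) (⟪⟫-∷∷ x ys x ys))
    (regroup (c x x) (row x xs) (row x ys) (col x xs) (col x ys) ⟪ xs , xs ⟫ ⟪ ys , ys ⟫)
    where
    regroup : ∀ C R₁ R₂ K₁ K₂ S T →
      ((C + R₁) + (K₁ + S)) + ((C + R₂) + (K₂ + T)) ≡ ((C + R₁ + K₁) + (C + R₂ + K₂)) + (S + T)
    regroup = solve-∀

  module _ {x y} (x∼y : x ∼ y) (xs ys₁ ys₂ : List A) where

    private
      ys = ys₁ ++ ys₂
      y∼x = ∼-sym x∼y
      shift = ↭.shift y ys₁ ys₂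

    mixed-matched : mixed (x ∷ xs) (ys₁ ++ y ∷ ys₂) ≡ shared x xs ys + mixed xs ys
    mixed-matched = begin
      mixed (x ∷ xs) (ys₁ ++ y ∷ ys₂)    ≡⟨ cong₂ _+_ (⟪⟫-↭ʳ (x ∷ xs) shift) (⟪⟫-↭ˡ (x ∷ xs) shift) ⟩
      mixed (x ∷ xs) (y ∷ ys)            ≡⟨ cong₂ _+_ (⟪⟫-∼ʳ y∼x (x ∷ xs) ys) (⟪⟫-∼ˡ y∼x ys (x ∷ xs)) ⟩
      mixed (x ∷ xs) (x ∷ ys)            ≡⟨ mixed-∷ x xs ys ⟩
      shared x xs ys + mixed xs ys       ∎
      where open ≡-Reasoning

    pure-matched : pure (x ∷ xs) (ys₁ ++ y ∷ ys₂) ≡ shared x xs ys + pure xs ys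
    pure-matched = begin
      pure (x ∷ xs) (ys₁ ++ y ∷ ys₂)     ≡⟨ cong (⟪ x ∷ xs , x ∷ xs ⟫ +_) (trans (⟪⟫-↭ˡ (ys₁ ++ y ∷ ys₂) shift) (⟪⟫-↭ʳ (y ∷ ys) shift)) ⟩
      pure (x ∷ xs) (y ∷ ys)             ≡⟨ cong (⟪ x ∷ xs , x ∷ xs ⟫ +_) (trans (⟪⟫-∼ˡ y∼x ys (y ∷ ys)) (⟪⟫-∼ʳ y∼x (x ∷ ys) ys)) ⟩
      pure (x ∷ xs) (x ∷ ys)             ≡⟨ pure-∷ x xs ys ⟩
      shared x xs ys + pure xs ys        ∎
      where open ≡-Reasoning

  unrelated⇒c≡0 : ∀ {x y} → ¬ x ∼ y → c x y ≡ 0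
  unrelated⇒c≡0 ¬x∼y = n≤0⇒n≡0 (≮⇒≥ ¬x∼y)

  module _ {x : A} (xs : List A) {ys : List A} (x≁ys : All (λ y → ¬ x ∼ y) ys) where

    private
      row≡0 : ∀ {zs} → All (λ z → ¬ x ∼ z) zs → row x zs ≡ 0
      row≡0 []           = refl
      row≡0 (x≁z ∷ x≁zs) = cong₂ _+_ (unrelated⇒c≡0 x≁z) (row≡0 x≁zs)

      col≡0 : ∀ {zs} → All (λ z → ¬ x ∼ z) zs → col x zs ≡ 0
      col≡0 []           = refl
      col≡0 (x≁z ∷ x≁zs) = cong₂ _+_ (unrelated⇒c≡0 (x≁z ∘ ∼-sym)) (col≡0 x≁zs)

    mixed-unmatched : mixed (x ∷ xs) ys ≡ mixed xs ys
    mixed-unmatched = cong₂ _+_ (cong (_+ ⟪ xs , ys ⟫) (row≡0 x≁ys))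
                                (trans (⟪⟫-∷ʳ ys x xs) (cong (_+ ⟪ ys , xs ⟫) (col≡0 x≁ys)))

    pure-unmatched : pure xs ys < pure (x ∷ xs) ys
    pure-unmatched = +-monoˡ-< ⟪ ys , ys ⟫ (⟪⟫-self-< x xs)

  data Match (x : A) : List A → Set a where
    matched   : ∀ ys₁ {y} ys₂ → x ∼ y → Match x (ys₁ ++ y ∷ ys₂)
    unmatched : ∀ {ys} → All (λ y → ¬ x ∼ y) ys → Match x ys

  match : ∀ x ys → Match x ys
  match x []       = unmatched []
  match x (y ∷ ys) with x ∼? y
  ... | yes x∼y = matched [] ys x∼y
  ... | no  x≁y with match x ys
  ...   | matched ys₁ ys₂ x∼z = matched (y ∷ ys₁) ys₂ x∼z
  ...   | unmatched x≁ys     = unmatched (x≁y ∷ x≁ys)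

  mixed-[] : ∀ ys → mixed [] ys ≡ 0
  mixed-[] ys = ∑-zero ys

  mixed≤pure : ∀ xs ys → mixed xs ys ≤ pure xs ys
  mixed≤pure []       ys = subst (_≤ pure [] ys) (sym (mixed-[] ys)) z≤n
  mixed≤pure (x ∷ xs) ys with match x ys
  ... | matched ys₁ {y} ys₂ x∼y = begin
    mixed (x ∷ xs) (ys₁ ++ y ∷ ys₂)               ≡⟨ mixed-matched x∼y xs ys₁ ys₂ ⟩
    shared x xs (ys₁ ++ ys₂) + mixed xs (ys₁ ++ ys₂) ≤⟨ +-monoʳ-≤ (shared x xs (ys₁ ++ ys₂)) (mixed≤pure xs (ys₁ ++ ys₂)) ⟩
    shared x xs (ys₁ ++ ys₂) + pure xs (ys₁ ++ ys₂)  ≡⟨ pure-matched x∼y xs ys₁ ys₂ ⟨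
    pure (x ∷ xs) (ys₁ ++ y ∷ ys₂)                ∎
    where open ≤-Reasoning
  ... | unmatched x≁ys = begin
    mixed (x ∷ xs) ys  ≡⟨ mixed-unmatched xs x≁ys ⟩
    mixed xs ys        ≤⟨ mixed≤pure xs ys ⟩
    pure xs ys         ≤⟨ <⇒≤ (pure-unmatched xs x≁ys) ⟩
    pure (x ∷ xs) ys   ∎
    where open ≤-Reasoning

  mixed≡pure⇒↭ : ∀ xs ys → mixed xs ys ≡ pure xs ys → xs ↭∼ ys
  mixed≡pure⇒↭ []       []       _  = ∼Perm.↭-refl
  mixed≡pure⇒↭ []       (y ∷ ys) eq = ⊥-elim (n≮0 (subst (⟪ ys , ys ⟫ <_) (trans (sym eq) (mixed-[] (y ∷ ys))) (⟪⟫-self-< y ys)))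
  mixed≡pure⇒↭ (x ∷ xs) ys       eq with match x ys
  ... | matched ys₁ {y} ys₂ x∼y =
    ∼Perm.↭-trans (∼Perm.↭-prep x (mixed≡pure⇒↭ xs (ys₁ ++ ys₂) eq′)) (∼Perm.↭-sym (↭∼-shift (∼-sym x∼y) ys₁ ys₂))
    where
    eq′ : mixed xs (ys₁ ++ ys₂) ≡ pure xs (ys₁ ++ ys₂)
    eq′ = +-cancelˡ-≡ (shared x xs (ys₁ ++ ys₂)) _ _
            (trans (sym (mixed-matched x∼y xs ys₁ ys₂)) (trans eq (pure-matched x∼y xs ys₁ ys₂)))
  ... | unmatched x≁ys = ⊥-elim (<⇒≱ (pure-unmatched xs x≁ys) (begin
    pure (x ∷ xs) ys   ≡⟨ eq ⟨
    mixed (x ∷ xs) ys  ≡⟨ mixed-unmatched xs x≁ys ⟩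
    mixed xs ys        ≤⟨ mixed≤pure xs ys ⟩
    pure xs ys         ∎))
    where open ≤-Reasoning

-- Counting isomorphisms

module _ {n : ℕ} where

  record IsIsomorphism (X Y : Adj n) (f g : Fin n → Fin n) : Set where
    field
      inverseˡ : ∀ y → f (g y) ≡ y
      inverseʳ : ∀ x → g (f x) ≡ x
      homo     : ∀ x y → X x y ≡ Y (f x) (f y)

  open IsIsomorphism

  isIsomorphism? : ∀ X Y f g → Dec (IsIsomorphism X Y f g)
  isIsomorphism? X Y f g = map′ (λ (l , r , h) → record { inverseˡ = l ; inverseʳ = r ; homo = h })
                                (λ i → inverseˡ i , inverseʳ i , homo i)
    (all? (λ y → f (g y) ≟ y) ×-dec all? (λ x → g (f x) ≟ x) ×-dec
     all? (λ x → all? (λ y → X x y ≟ᵇ Y (f x) (f y))))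

  IsIsomorphism-id : ∀ {X} → IsIsomorphism X X id id
  IsIsomorphism-id = record { inverseˡ = λ _ → refl ; inverseʳ = λ _ → refl ; homo = λ _ _ → refl }

  module _ {X Y : Adj n} where

    IsIsomorphism-flip : ∀ {f g} → IsIsomorphism X Y f g → IsIsomorphism Y X g f
    IsIsomorphism-flip {f} {g} i = record
      { inverseˡ = inverseʳ i
      ; inverseʳ = inverseˡ i
      ; homo     = λ x y → sym (trans (homo i (g x) (g y)) (cong₂ Y (inverseˡ i x) (inverseˡ i y)))
      }

    IsIsomorphism-∘ : ∀ {Z f g f′ g′} → IsIsomorphism X Y f g → IsIsomorphism Y Z f′ g′ →
                      IsIsomorphism X Z (f′ ∘ f) (g ∘ g′)
    IsIsomorphism-∘ {f = f} {g} {f′} {g′} i j = record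
      { inverseˡ = λ z → trans (cong f′ (inverseˡ i (g′ z))) (inverseˡ j z)
      ; inverseʳ = λ x → trans (cong g (inverseʳ j (f x))) (inverseʳ i x)
      ; homo     = λ x y → trans (homo i x y) (homo j (f x) (f y))
      }

    IsIsomorphism-≗ : ∀ {f g f′ g′} → (∀ x → f x ≡ f′ x) → (∀ y → g y ≡ g′ y) →
                      IsIsomorphism X Y f g → IsIsomorphism X Y f′ g′
    IsIsomorphism-≗ {f} {g} {f′} {g′} f≗f′ g≗g′ i = record
      { inverseˡ = λ y → trans (sym (trans (f≗f′ (g y)) (cong f′ (g≗g′ y)))) (inverseˡ i y)
      ; inverseʳ = λ x → trans (sym (trans (g≗g′ (f x)) (cong g′ (f≗f′ x)))) (inverseʳ i x)
      ; homo     = λ x y → trans (homo i x y) (cong₂ Y (f≗f′ x) (f≗f′ y))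
      }

    ≅⇒IsIsomorphism : (X≅Y : X ≅ Y) → IsIsomorphism X Y (Inverse.to (proj₁ X≅Y)) (Inverse.from (proj₁ X≅Y))
    ≅⇒IsIsomorphism (σ , h) = record
      { inverseˡ = Inverse.strictlyInverseˡ σ ; inverseʳ = Inverse.strictlyInverseʳ σ ; homo = h }

    IsIsomorphism⇒≅ : ∀ {f g} → IsIsomorphism X Y f g → X ≅ Y
    IsIsomorphism⇒≅ {f} {g} i = mk↔ₛ′ f g (inverseˡ i) (inverseʳ i) , homo i

vectors : ∀ n k → List (Vec (Fin n) k)
vectors n zero    = [] ∷ []
vectors n (suc k) = cartesianProductWith _∷_ (allFin n) (vectors n k)

vectors-unique : ∀ n k → Unique (vectors n k)
vectors-unique n zero    = All.[] ∷ []
vectors-unique n (suc k) = Unique.cartesianProductWith⁺ _∷_ ∷-injective (Unique.allFin⁺ n) (vectors-unique n k)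

∈-vectors : ∀ {n k} (v : Vec (Fin n) k) → v ∈ vectors n k
∈-vectors []      = here refl
∈-vectors (x ∷ v) = ∈-cartesianProductWith⁺ _∷_ (∈-allFin x) (∈-vectors v)

-- A permutation is represented by the vectors of its values and of its inverse's values:
-- bijectivity becomes decidable, and each permutation is exactly one valid candidate.
Candidate : ℕ → Set
Candidate n = Vec (Fin n) n × Vec (Fin n) n

candidates : ∀ n → List (Candidate n)
candidates n = cartesianProduct (vectors n n) (vectors n n)

candidates-unique : ∀ n → Unique (candidates n)
candidates-unique n = Unique.cartesianProduct⁺ (vectors-unique n n) (vectors-unique n n)

∈-candidates : ∀ {n} (s : Candidate n) → s ∈ candidates n
∈-candidates (σ , ρ) = ∈-cartesianProduct⁺ (∈-vectors σ) (∈-vectors ρ)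

module _ {n : ℕ} where

  IsIsoCandidate : Adj n → Adj n → Candidate n → Set
  IsIsoCandidate X Y (σ , ρ) = IsIsomorphism X Y (lookup σ) (lookup ρ)

  isIsoCandidate? : ∀ X Y (s : Candidate n) → Dec (IsIsoCandidate X Y s)
  isIsoCandidate? X Y (σ , ρ) = isIsomorphism? X Y (lookup σ) (lookup ρ)

  #iso : Adj n → Adj n → ℕ
  #iso X Y = ∑[ s ∈ candidates n ] 𝟙 (isIsoCandidate? X Y s)

  #iso-pos⇒≅ : ∀ {X Y} → 0 < #iso X Y → X ≅ Y
  #iso-pos⇒≅ {X} {Y} pos with ∑-𝟙-pos⇒∃ (isIsoCandidate? X Y) (candidates n) pos
  ... | _ , i = IsIsomorphism⇒≅ i

  #iso-self-pos : ∀ X → 0 < #iso X X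
  #iso-self-pos X = ∑-𝟙-pos (isIsoCandidate? X X) (∈-candidates (tabulate id , tabulate id))
    (IsIsomorphism-≗ (sym ∘ lookup∘tabulate id) (sym ∘ lookup∘tabulate id) IsIsomorphism-id)

  #iso-transport : ∀ {X Y X′ Y′} (Φ Ψ : Candidate n → Candidate n) →
                   (∀ s → Ψ (Φ s) ≡ s) → (∀ s → Φ (Ψ s) ≡ s) →
                   (∀ s → IsIsoCandidate X Y s → IsIsoCandidate X′ Y′ (Φ s)) →
                   (∀ s → IsIsoCandidate X′ Y′ s → IsIsoCandidate X Y (Ψ s)) →
                   #iso X Y ≡ #iso X′ Y′
  #iso-transport {X} {Y} {X′} {Y′} Φ Ψ ΨΦ ΦΨ forth back = trans
    (∑-cong (candidates n) λ s → 𝟙-cong (isIsoCandidate? X Y s) (isIsoCandidate? X′ Y′ (Φ s))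
                                        (forth s) (subst (IsIsoCandidate X Y) (ΨΦ s) ∘ back (Φ s)))
    (∑-reindex Φ Ψ (λ _ → ∈-candidates _) (λ _ → ∈-candidates _) (λ _ → ΨΦ _) (λ _ → ΦΨ _)
               (candidates-unique n) (candidates-unique n) (𝟙 ∘ isIsoCandidate? X′ Y′))

  #iso-sym : ∀ X Y → #iso X Y ≡ #iso Y X
  #iso-sym X Y = #iso-transport swap swap (λ _ → refl) (λ _ → refl)
                   (λ _ → IsIsomorphism-flip) (λ _ → IsIsomorphism-flip)
    where
    swap : Candidate n → Candidate n
    swap (σ , ρ) = ρ , σ

  postcompose : (Fin n → Fin n) → (Fin n → Fin n) → Candidate n → Candidate n
  postcompose τ τ′ (σ , ρ) = tabulate (τ ∘ lookup σ) , tabulate (lookup ρ ∘ τ′)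

  postcompose-inverse : ∀ {τ τ′} → (∀ x → τ′ (τ x) ≡ x) → ∀ s → postcompose τ′ τ (postcompose τ τ′ s) ≡ s
  postcompose-inverse {τ} {τ′} τ′τ (σ , ρ) = cong₂ _,_
    (tabulate-lookup λ i → trans (cong τ′ (lookup∘tabulate _ i)) (τ′τ (lookup σ i)))
    (tabulate-lookup λ i → trans (lookup∘tabulate _ (τ i)) (cong (lookup ρ) (τ′τ i)))
    where
    tabulate-lookup : ∀ {f} {v : Vec (Fin n) n} → (∀ i → f i ≡ lookup v i) → tabulate f ≡ v
    tabulate-lookup {v = v} f≗v = trans (tabulate-cong f≗v) (tabulate∘lookup v)

  postcompose-iso : ∀ {X Y Y′ τ τ′} → IsIsomorphism Y Y′ τ τ′ →
                    ∀ s → IsIsoCandidate X Y s → IsIsoCandidate X Y′ (postcompose τ τ′ s)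
  postcompose-iso {τ = τ} {τ′} τ-iso (σ , ρ) i =
    IsIsomorphism-≗ (sym ∘ lookup∘tabulate (τ ∘ lookup σ)) (sym ∘ lookup∘tabulate (lookup ρ ∘ τ′))
                    (IsIsomorphism-∘ i τ-iso)

  #iso-congʳ : ∀ X {Y Y′} → Y ≅ Y′ → #iso X Y ≡ #iso X Y′
  #iso-congʳ X {Y} {Y′} Y≅Y′ = #iso-transport (postcompose τ τ′) (postcompose τ′ τ)
    (postcompose-inverse (IsIsomorphism.inverseʳ τ-iso)) (postcompose-inverse (IsIsomorphism.inverseˡ τ-iso))
    (postcompose-iso τ-iso) (postcompose-iso (IsIsomorphism-flip τ-iso))
    where
    τ τ′ : Fin n → Fin n
    τ  = Inverse.to (proj₁ Y≅Y′)
    τ′ = Inverse.from (proj₁ Y≅Y′)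
    τ-iso : IsIsomorphism Y Y′ τ τ′
    τ-iso = ≅⇒IsIsomorphism Y≅Y′

  #iso-congˡ : ∀ {X X′} Y → X ≅ X′ → #iso X Y ≡ #iso X′ Y
  #iso-congˡ {X} {X′} Y X≅X′ = begin
    #iso X Y   ≡⟨ #iso-sym X Y ⟩
    #iso Y X   ≡⟨ #iso-congʳ Y {X} {X′} X≅X′ ⟩
    #iso Y X′  ≡⟨ #iso-sym Y X′ ⟩
    #iso X′ Y  ∎
    where open ≡-Reasoning

module _ {n : ℕ} where

  ordered? : (p : Pair n) → Dec (proj₁ p Fin.< proj₂ p)
  ordered? (i , j) = i Fin.<? j

  private
    filter-ordered-map : ∀ i (js : List (Fin n)) → filter ordered? (map (i ,_) js) ≡ map (i ,_) (filter (i Fin.<?_) js)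
    filter-ordered-map i []       = refl
    filter-ordered-map i (j ∷ js) with does (i Fin.<? j)
    ... | true  = cong ((i , j) ∷_) (filter-ordered-map i js)
    ... | false = filter-ordered-map i js

    concatMap-rows≡filter-ordered : ∀ is → concatMap (λ i → map (i ,_) (filter (i Fin.<?_) (allFin n))) is
                       ≡ filter ordered? (cartesianProduct is (allFin n))
    concatMap-rows≡filter-ordered []       = refl
    concatMap-rows≡filter-ordered (i ∷ is) = trans (cong₂ _++_ (sym (filter-ordered-map i (allFin n))) (concatMap-rows≡filter-ordered is))
                                (sym (filter-++ ordered? (map (i ,_) (allFin n)) (cartesianProduct is (allFin n))))

  pairs≡ordered : pairs n ≡ filter ordered? (cartesianProduct (allFin n) (allFin n))
  pairs≡ordered = concatMap-rows≡filter-ordered (allFin n)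

  pairs-unique : Unique (pairs n)
  pairs-unique = subst Unique (sym pairs≡ordered)
    (Unique.filter⁺ ordered? (Unique.cartesianProduct⁺ (Unique.allFin⁺ n) (Unique.allFin⁺ n)))

  ∈-pairs⁺ : ∀ {i j : Fin n} → i Fin.< j → (i , j) ∈ pairs n
  ∈-pairs⁺ {i} {j} i<j = subst ((i , j) ∈_) (sym pairs≡ordered)
    (∈-filter⁺ ordered? {xs = cartesianProduct (allFin n) (allFin n)} (∈-cartesianProduct⁺ (∈-allFin i) (∈-allFin j)) i<j)

  ∈-pairs⁻ : ∀ {i j : Fin n} → (i , j) ∈ pairs n → i Fin.< j
  ∈-pairs⁻ {i} {j} ij∈ = proj₂ (∈-filter⁻ ordered? {xs = cartesianProduct (allFin n) (allFin n)} (subst ((i , j) ∈_) pairs≡ordered ij∈))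

  unordered : Fin n → Fin n → Pair n
  unordered a b with <-cmp a b
  ... | tri< _ _ _ = a , b
  ... | tri≈ _ _ _ = a , b
  ... | tri> _ _ _ = b , a

  unordered-cases : ∀ a b → unordered a b ≡ (a , b) ⊎ unordered a b ≡ (b , a)
  unordered-cases a b with <-cmp a b
  ... | tri< _ _ _ = inj₁ refl
  ... | tri≈ _ _ _ = inj₁ refl
  ... | tri> _ _ _ = inj₂ refl

  unordered-< : ∀ {a b} → a Fin.< b → unordered a b ≡ (a , b)
  unordered-< {a} {b} a<b with <-cmp a b
  ... | tri< _ _ _   = refl
  ... | tri≈ _ _ _   = refl
  ... | tri> _ _ b<a = ⊥-elim (<-asym a<b b<a)

  unordered-> : ∀ {a b} → b Fin.< a → unordered a b ≡ (b , a)
  unordered-> {a} {b} b<a with <-cmp a b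
  ... | tri< a<b _ _ = ⊥-elim (<-asym a<b b<a)
  ... | tri≈ _ a≡b _ = ⊥-elim (<⇒≢ b<a (sym a≡b))
  ... | tri> _ _ _   = refl

  unordered-∈ : ∀ {a b} → a ≢ b → unordered a b ∈ pairs n
  unordered-∈ {a} {b} a≢b with <-cmp a b
  ... | tri< a<b _ _ = ∈-pairs⁺ a<b
  ... | tri≈ _ a≡b _ = ⊥-elim (a≢b a≡b)
  ... | tri> _ _ b<a = ∈-pairs⁺ b<a

  mapPair : (Fin n → Fin n) → Pair n → Pair n
  mapPair τ (a , b) = unordered (τ a) (τ b)

  module _ {τ τ′ : Fin n → Fin n} (τ′τ : ∀ x → τ′ (τ x) ≡ x) where

    mapPair-∈ : ∀ {p} → p ∈ pairs n → mapPair τ p ∈ pairs n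
    mapPair-∈ {a , b} ab∈ = unordered-∈ (λ τa≡τb → <⇒≢ (∈-pairs⁻ ab∈) (trans (sym (τ′τ a)) (trans (cong τ′ τa≡τb) (τ′τ b))))

    mapPair-inverse : ∀ {p} → p ∈ pairs n → mapPair τ′ (mapPair τ p) ≡ p
    mapPair-inverse {a , b} ab∈ with unordered-cases (τ a) (τ b)
    ... | inj₁ eq rewrite eq | τ′τ a | τ′τ b = unordered-< (∈-pairs⁻ ab∈)
    ... | inj₂ eq rewrite eq | τ′τ a | τ′τ b = unordered-> (∈-pairs⁻ ab∈)

    ⌊≟⌋-injective : ∀ x y → ⌊ τ x ≟ τ y ⌋ ≡ ⌊ x ≟ y ⌋
    ⌊≟⌋-injective x y with x ≟ y | τ x ≟ τ y
    ... | yes _    | yes _     = refl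
    ... | no  _    | no  _     = refl
    ... | yes refl | no τx≢τx  = ⊥-elim (τx≢τx refl)
    ... | no  x≢y  | yes τx≡τy = ⊥-elim (x≢y (trans (sym (τ′τ x)) (trans (cong τ′ τx≡τy) (τ′τ y))))

    isPair-mapPair : ∀ p x y → isPair (mapPair τ p) (τ x) (τ y) ≡ isPair p x y
    isPair-mapPair (a , b) x y with unordered-cases (τ a) (τ b)
    ... | inj₁ eq rewrite eq | ⌊≟⌋-injective x a | ⌊≟⌋-injective y b | ⌊≟⌋-injective x b | ⌊≟⌋-injective y a = refl
    ... | inj₂ eq rewrite eq | ⌊≟⌋-injective x a | ⌊≟⌋-injective y b | ⌊≟⌋-injective x b | ⌊≟⌋-injective y a =
      ∨-comm (⌊ x ≟ b ⌋ ∧ ⌊ y ≟ a ⌋) (⌊ x ≟ a ⌋ ∧ ⌊ y ≟ b ⌋)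

  isPair-comm : ∀ (p : Pair n) x y → isPair p x y ≡ isPair p y x
  isPair-comm (a , b) x y = trans (∨-comm (⌊ x ≟ a ⌋ ∧ ⌊ y ≟ b ⌋) (⌊ x ≟ b ⌋ ∧ ⌊ y ≟ a ⌋))
                                  (cong₂ _∨_ (∧-comm ⌊ x ≟ b ⌋ ⌊ y ≟ a ⌋) (∧-comm ⌊ x ≟ a ⌋ ⌊ y ≟ b ⌋))

  isPair-self : ∀ (a b : Fin n) → isPair (a , b) a b ≡ true
  isPair-self a b with a ≟ a | b ≟ b
  ... | yes _ | yes _   = refl
  ... | no a≢a | _      = ⊥-elim (a≢a refl)
  ... | yes _ | no b≢b  = ⊥-elim (b≢b refl)

  isPair-sound : ∀ {a b x y : Fin n} → T (isPair (a , b) x y) → (x ≡ a × y ≡ b) ⊎ (x ≡ b × y ≡ a)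
  isPair-sound {a} {b} {x} {y} t with x ≟ a | y ≟ b | x ≟ b | y ≟ a
  ... | yes x≡a | yes y≡b | _       | _       = inj₁ (x≡a , y≡b)
  ... | _       | _       | yes x≡b | yes y≡a = inj₂ (x≡b , y≡a)
  ... | yes _   | no _    | yes _   | no _    = ⊥-elim t
  ... | yes _   | no _    | no _    | _       = ⊥-elim t
  ... | no _    | _       | yes _   | no _    = ⊥-elim t
  ... | no _    | _       | no _    | _       = ⊥-elim t

-- Deleting an edge versus adding one

private
  deleted⇒added : ∀ {g k q : Bool} → (T q → g ≡ true) → g ∧ not q ≡ k → g ≡ k ∨ q
  deleted⇒added {g} {k} {true}  on-q _  = trans (on-q _) (sym (∨-zeroʳ k))
  deleted⇒added {g} {k} {false} _    eq = trans (sym (∧-identityʳ g)) (trans eq (sym (∨-identityʳ k)))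

  added⇒deleted : ∀ {g k q : Bool} → (T q → k ≡ false) → g ≡ k ∨ q → g ∧ not q ≡ k
  added⇒deleted {g} {k} {true}  on-q _  = trans (∧-zeroʳ g) (sym (on-q _))
  added⇒deleted {g} {k} {false} _    eq = trans (∧-identityʳ g) (trans eq (∨-identityʳ k))

module _ {n : ℕ} where

  open IsIsomorphism

  IsSymmetric : Adj n → Set
  IsSymmetric G = ∀ x y → G x y ≡ G y x

  delete-symmetric : ∀ {G} → IsSymmetric G → ∀ e → IsSymmetric (delete G e)
  delete-symmetric G-sym e x y = cong₂ (λ u v → u ∧ not v) (G-sym x y) (isPair-comm e x y)

  isPair⇒≡ : ∀ {F : Adj n} → IsSymmetric F → ∀ {a b x y : Fin n} → T (isPair (a , b) x y) → F x y ≡ F a b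
  isPair⇒≡ F-sym {a} {b} {x} {y} t with isPair-sound {a = a} {b} {x} {y} t
  ... | inj₁ (refl , refl) = refl
  ... | inj₂ (refl , refl) = F-sym b a

  module _ {G K : Adj n} (G-sym : IsSymmetric G) (K-sym : IsSymmetric K)
           {σ ρ : Fin n → Fin n} (ρσ : ∀ x → ρ (σ x) ≡ x) (i j : Fin n) where

    private
      e′ = mapPair σ (i , j)
      a = proj₁ e′
      b = proj₂ e′

      isPair-e′ : ∀ x y → isPair e′ (σ x) (σ y) ≡ isPair (i , j) x y
      isPair-e′ = isPair-mapPair {τ = σ} {ρ} ρσ (i , j)

      K-e′ : K (σ i) (σ j) ≡ K a b
      K-e′ = isPair⇒≡ K-sym (subst T (sym (trans (isPair-e′ i j) (isPair-self i j))) _)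

    deleted-iso⇒added-iso : T (G i j) × IsIsomorphism (delete G (i , j)) K σ ρ →
                            T (not (K a b)) × IsIsomorphism G (add K e′) σ ρ
    deleted-iso⇒added-iso (Gij , iso) = Equivalence.from (T-not-≡ {K a b}) Kab≡false , record
      { inverseˡ = inverseˡ iso
      ; inverseʳ = inverseʳ iso
      ; homo     = λ x y → trans (deleted⇒added (on-ij x y) (homo iso x y))
                                 (cong (K (σ x) (σ y) ∨_) (sym (isPair-e′ x y)))
      }
      where
      open ≡-Reasoning
      Kab≡false : K a b ≡ false
      Kab≡false = begin
        K a b                                      ≡⟨ K-e′ ⟨
        K (σ i) (σ j)                              ≡⟨ homo iso i j ⟨
        G i j ∧ not (isPair (i , j) i j)           ≡⟨ cong (λ q → G i j ∧ not q) (isPair-self i j) ⟩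
        G i j ∧ false                              ≡⟨ ∧-zeroʳ (G i j) ⟩
        false                                      ∎
      on-ij : ∀ x y → T (isPair (i , j) x y) → G x y ≡ true
      on-ij x y t = trans (isPair⇒≡ G-sym t) (Equivalence.to (T-≡ {G i j}) Gij)

    added-iso⇒deleted-iso : T (not (K a b)) × IsIsomorphism G (add K e′) σ ρ →
                            T (G i j) × IsIsomorphism (delete G (i , j)) K σ ρ
    added-iso⇒deleted-iso (¬Kab , iso) = Equivalence.from (T-≡ {G i j}) Gij≡true , record
      { inverseˡ = inverseˡ iso
      ; inverseʳ = inverseʳ iso
      ; homo     = λ x y → added⇒deleted (on-ij x y)
                             (trans (homo iso x y) (cong (K (σ x) (σ y) ∨_) (isPair-e′ x y)))
      }
      where
      open ≡-Reasoning
      Gij≡true : G i j ≡ true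
      Gij≡true = begin
        G i j                                      ≡⟨ homo iso i j ⟩
        K (σ i) (σ j) ∨ isPair e′ (σ i) (σ j)      ≡⟨ cong (K (σ i) (σ j) ∨_) (trans (isPair-e′ i j) (isPair-self i j)) ⟩
        K (σ i) (σ j) ∨ true                       ≡⟨ ∨-zeroʳ (K (σ i) (σ j)) ⟩
        true                                       ∎
      on-ij : ∀ x y → T (isPair (i , j) x y) → K (σ x) (σ y) ≡ false
      on-ij x y t = trans (isPair⇒≡ (λ u v → K-sym (σ u) (σ v)) t)
                          (trans K-e′ (Equivalence.to (T-not-≡ {K a b}) ¬Kab))

  module _ {G K : Adj n} (G-sym : IsSymmetric G) (K-sym : IsSymmetric K) where

    ∑-deleteIso≡∑-addIso : ∀ σ ρ → ∑[ e ∈ edges G ] 𝟙 (isIsomorphism? (delete G e) K σ ρ)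
                                 ≡ ∑[ f ∈ nonEdges K ] 𝟙 (isIsomorphism? G (add K f) σ ρ)
    ∑-deleteIso≡∑-addIso σ ρ with all? (λ x → ρ (σ x) ≟ x) ×-dec all? (λ y → σ (ρ y) ≟ y)
    ... | no ¬inverses = trans
      (∑-𝟙-none (λ e → isIsomorphism? (delete G e) K σ ρ) (edges G) (λ _ iso → ¬inverses (inverseʳ iso , inverseˡ iso)))
      (sym (∑-𝟙-none (λ f → isIsomorphism? G (add K f) σ ρ) (nonEdges K) (λ _ iso → ¬inverses (inverseʳ iso , inverseˡ iso))))
    ... | yes (ρσ , σρ) = begin
      ∑[ e ∈ edges G ] 𝟙 (deleteIso? e)
        ≡⟨ ∑-𝟙-filter edge? deleteIso? (pairs n) ⟩
      ∑[ e ∈ pairs n ] 𝟙 (edge? e ×-dec deleteIso? e)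
        ≡⟨ ∑-cong (pairs n) deleted≡added ⟩
      ∑[ e ∈ pairs n ] 𝟙 (nonEdge? (mapPair σ e) ×-dec addIso? (mapPair σ e))
        ≡⟨ ∑-reindex (mapPair σ) (mapPair ρ) (mapPair-∈ {τ = σ} {ρ} ρσ) (mapPair-∈ {τ = ρ} {σ} σρ)
                     (mapPair-inverse {τ = σ} {ρ} ρσ) (mapPair-inverse {τ = ρ} {σ} σρ)
                     pairs-unique pairs-unique (λ f → 𝟙 (nonEdge? f ×-dec addIso? f)) ⟩
      ∑[ f ∈ pairs n ] 𝟙 (nonEdge? f ×-dec addIso? f)
        ≡⟨ ∑-𝟙-filter nonEdge? addIso? (pairs n) ⟨
      ∑[ f ∈ nonEdges K ] 𝟙 (addIso? f)
        ∎
      where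
      open ≡-Reasoning
      edge? nonEdge? : (p : Pair n) → _
      edge? (x , y) = T? (G x y)
      nonEdge? (x , y) = T? (not (K x y))
      deleteIso? addIso? : (p : Pair n) → _
      deleteIso? e = isIsomorphism? (delete G e) K σ ρ
      addIso? f = isIsomorphism? G (add K f) σ ρ
      deleted≡added : ∀ e → 𝟙 (edge? e ×-dec deleteIso? e) ≡ 𝟙 (nonEdge? (mapPair σ e) ×-dec addIso? (mapPair σ e))
      deleted≡added e@(i , j) = 𝟙-cong (edge? e ×-dec deleteIso? e) (nonEdge? (mapPair σ e) ×-dec addIso? (mapPair σ e))
        (deleted-iso⇒added-iso G-sym K-sym {σ} {ρ} ρσ i j) (added-iso⇒deleted-iso G-sym K-sym {σ} {ρ} ρσ i j)

    ∑-#iso-delete≡∑-#iso-add : ∑[ e ∈ edges G ] #iso (delete G e) K ≡ ∑[ f ∈ nonEdges K ] #iso G (add K f)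
    ∑-#iso-delete≡∑-#iso-add = begin
      ∑[ e ∈ edges G ] ∑[ s ∈ candidates n ] 𝟙 (isIsoCandidate? (delete G e) K s)
        ≡⟨ ∑-comm _ (edges G) (candidates n) ⟩
      ∑[ s ∈ candidates n ] ∑[ e ∈ edges G ] 𝟙 (isIsoCandidate? (delete G e) K s)
        ≡⟨ ∑-cong (candidates n) (λ (σ , ρ) → ∑-deleteIso≡∑-addIso (lookup σ) (lookup ρ)) ⟩
      ∑[ s ∈ candidates n ] ∑[ f ∈ nonEdges K ] 𝟙 (isIsoCandidate? G (add K f) s)
        ≡⟨ ∑-comm _ (candidates n) (nonEdges K) ⟩
      ∑[ f ∈ nonEdges K ] ∑[ s ∈ candidates n ] 𝟙 (isIsoCandidate? G (add K f) s)
        ∎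
      where open ≡-Reasoning

-- Edge decks and modified decks

module _ {n : ℕ} where

  open PositiveKernel (#iso {n}) #iso-self-pos
    (λ {X} {X′} Y pos → #iso-congˡ {X = X} {X′} Y (#iso-pos⇒≅ {X = X} {X′} pos))
    (λ {Y} {Y′} X pos → #iso-congʳ X {Y} {Y′} (#iso-pos⇒≅ {X = Y} {Y′} pos))

  ∑-#iso-≈ₘ : ∀ X {L M : List (Adj n)} → L ≈ₘ M → ∑[ Y ∈ L ] #iso X Y ≡ ∑[ Y ∈ M ] #iso X Y
  ∑-#iso-≈ₘ X {L} {M} (π , L≅M) = ∑-permute (#iso X) (#iso X) {L} {M} π (λ i → #iso-congʳ X {List.lookup L i} {List.lookup M (Inverse.to π i)} (L≅M i))

  ↭∼⇒≈ₘ : ∀ {L M : List (Adj n)} → L ↭∼ M → L ≈ₘ M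
  ↭∼⇒≈ₘ {L} {M} L↭M = onIndices L↭M , λ i →
    #iso-pos⇒≅ {X = List.lookup L i} {List.lookup M (Inverse.to (onIndices L↭M) i)} (onIndices-lookup ∼-setoid L↭M i)

  ⟪ED₁,ED₁⟫≡∑MD₁ : ∀ {G H} → IsSymmetric G → IsSymmetric H → ⟪ ED₁ G , ED₁ H ⟫ ≡ ∑[ Y ∈ MD₁ H ] #iso G Y
  ⟪ED₁,ED₁⟫≡∑MD₁ {G} {H} G-sym H-sym = begin
    ∑[ X ∈ ED₁ G ] ∑[ Y ∈ ED₁ H ] #iso X Y
      ≡⟨ ∑-map _ (delete G) (edges G) ⟩
    ∑[ e ∈ edges G ] ∑[ Y ∈ ED₁ H ] #iso (delete G e) Y
      ≡⟨ ∑-cong (edges G) (λ e → ∑-map (#iso (delete G e)) (delete H) (edges H)) ⟩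
    ∑[ e ∈ edges G ] ∑[ e′ ∈ edges H ] #iso (delete G e) (delete H e′)
      ≡⟨ ∑-comm _ (edges G) (edges H) ⟩
    ∑[ e′ ∈ edges H ] ∑[ e ∈ edges G ] #iso (delete G e) (delete H e′)
      ≡⟨ ∑-cong (edges H) (λ e′ → ∑-#iso-delete≡∑-#iso-add G-sym (delete-symmetric H-sym e′)) ⟩
    ∑[ e′ ∈ edges H ] ∑[ f ∈ nonEdges (delete H e′) ] #iso G (add (delete H e′) f)
      ≡⟨ ∑-cong (edges H) (λ e′ → ∑-map (#iso G) (add (delete H e′)) (nonEdges (delete H e′))) ⟨
    ∑[ e′ ∈ edges H ] ∑[ Y ∈ map (add (delete H e′)) (nonEdges (delete H e′)) ] #iso G Y
      ≡⟨ ∑-concatMap (#iso G) (λ e′ → map (add (delete H e′)) (nonEdges (delete H e′))) (edges H) ⟨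
    ∑[ Y ∈ MD₁ H ] #iso G Y
      ∎
    where open ≡-Reasoning

  ⟪ED₁,ED₁⟫-congʳ : ∀ {G H H′} → IsSymmetric G → IsSymmetric H → IsSymmetric H′ →
                    MD₁ H ≈ₘ MD₁ H′ → ⟪ ED₁ G , ED₁ H ⟫ ≡ ⟪ ED₁ G , ED₁ H′ ⟫
  ⟪ED₁,ED₁⟫-congʳ {G} {H} {H′} G-sym H-sym H′-sym MD≈ = begin
    ⟪ ED₁ G , ED₁ H ⟫         ≡⟨ ⟪ED₁,ED₁⟫≡∑MD₁ G-sym H-sym ⟩
    ∑[ Y ∈ MD₁ H ] #iso G Y    ≡⟨ ∑-#iso-≈ₘ G {MD₁ H} {MD₁ H′} MD≈ ⟩
    ∑[ Y ∈ MD₁ H′ ] #iso G Y   ≡⟨ ⟪ED₁,ED₁⟫≡∑MD₁ G-sym H′-sym ⟨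
    ⟪ ED₁ G , ED₁ H′ ⟫        ∎
    where open ≡-Reasoning

  ED₁-from-MD₁ : ∀ {G H : Adj n} → IsSymmetric G → IsSymmetric H → MD₁ G ≈ₘ MD₁ H → ED₁ G ≈ₘ ED₁ H
  ED₁-from-MD₁ {G} {H} G-sym H-sym MD≈ = ↭∼⇒≈ₘ (mixed≡pure⇒↭ (ED₁ G) (ED₁ H) (cong₂ _+_
    (sym (⟪ED₁,ED₁⟫-congʳ G-sym G-sym H-sym MD≈))
    (⟪ED₁,ED₁⟫-congʳ H-sym G-sym H-sym MD≈)))

corollary2p7 : (n m : ℕ) (G H : Adj n) → IsSimple G → IsSimple H →
    length (edges G) ≡ m → length (edges H) ≡ m →
    MD₁ G ≈ₘ MD₁ H → ED₁ G ≈ₘ ED₁ H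
corollary2p7 n m G H G-simple H-simple _ _ = ED₁-from-MD₁ (IsSimple.sym G-simple) (IsSimple.sym H-simple)
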